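{- Let $G=C_k$ be a cycle with $k\ge 5$ and $k\ne 8$. Then $\mathcal{H}_3(G)$ is not ideal, and hence not Mengerian.
   Context: For a graph $G$, $\mathcal{H}_3(G)$ is the $4$-uniform hypergraph on $V(G)$ whose hyperedges are the $4$-element subsets of $V(G)$ that contain a path of length $3$ in $G$ (the vertices can be ordered $v_1,\dots,v_4$ with $\{v_i,v_{i+1}\}\in E(G)$ for $i=1,2,3$). A hypergraph with incidence matrix $A$ (rows indexed by hyperedges, columns by vertices) is ideal if the polyhedron $\{x: x\ge 0,\ Ax\ge \mathbf 1\}$ is integral (all its vertices are integral). It is Mengerian if for every $c\in\mathbb{Z}_{\ge0}^n$, $\min\{\langle c,x\rangle: x\ge0 \text{ integral}, Ax\ge\mathbf 1\}=\max\{\langle y,\mathbf 1\rangle : y\ge 0\text{ integral}, y^\top A\le c^\top\}$. -}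

module Defs where

open import Data.Nat as ℕ using (ℕ; zero; suc; _%_)
open import Data.Integer using (ℤ; +_)
open import Data.Rational as ℚ using (ℚ; 0ℚ; 1ℚ; _/_)
open import Data.Bool using (Bool; true; false; if_then_else_)
open import Data.Fin using (Fin; zero; suc; toℕ)
open import Data.Fin.Subset using (Subset; _∈_; ∣_∣)
open import Data.Vec using (Vec; []; _∷_; lookup)
open import Data.List using (List; []; _∷_; map; _++_)
open import Data.Nat.ListAction using (sum)
open import Data.Product using (Σ; ∃; _×_; _,_)
open import Relation.Binary.PropositionalEquality using (_≡_; _≢_)
open import Level using (0ℓ)

record Graph (n : ℕ) : Set₁ where
  field
    Adj : Fin n → Fin n → Set

open Graph public

Cycle : (k : ℕ) → .{{_ : ℕ.NonZero k}} → Graph k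
Cycle k = record { Adj = λ i j → (toℕ j ≡ (suc (toℕ i)) % k) Data.Sum.⊎ (toℕ i ≡ (suc (toℕ j)) % k) }
  where import Data.Sum

Hypergraph : ℕ → Set₁
Hypergraph n = Subset n → Set

H3 : ∀ {n} → Graph n → Hypergraph n
H3 G S =
  ∣ S ∣ ≡ 4 ×
  Σ (Fin _) λ v₁ → Σ (Fin _) λ v₂ → Σ (Fin _) λ v₃ → Σ (Fin _) λ v₄ →
    (v₁ ∈ S × v₂ ∈ S × v₃ ∈ S × v₄ ∈ S) ×
    (v₁ ≢ v₂ × v₁ ≢ v₃ × v₁ ≢ v₄ × v₂ ≢ v₃ × v₂ ≢ v₄ × v₃ ≢ v₄) ×
    (Adj G v₁ v₂ × Adj G v₂ v₃ × Adj G v₃ v₄)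

sumOverℚ : ∀ {n} → Subset n → (Fin n → ℚ) → ℚ
sumOverℚ []          f = 0ℚ
sumOverℚ (true ∷ s)  f = f zero ℚ.+ sumOverℚ s (λ i → f (suc i))
sumOverℚ (false ∷ s) f = sumOverℚ s (λ i → f (suc i))

sumOverℕ : ∀ {n} → Subset n → (Fin n → ℕ) → ℕ
sumOverℕ []          f = 0
sumOverℕ (true ∷ s)  f = f zero ℕ.+ sumOverℕ s (λ i → f (suc i))
sumOverℕ (false ∷ s) f = sumOverℕ s (λ i → f (suc i))

allSubsets : (n : ℕ) → List (Subset n)
allSubsets zero    = [] ∷ []
allSubsets (suc n) = map (true ∷_) (allSubsets n) ++ map (false ∷_) (allSubsets n)

Point : ℕ → Set
Point n = Fin n → ℚ

InPolyhedron : ∀ {n} → Hypergraph n → Point n → Set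
InPolyhedron H x =
  (∀ i → 0ℚ ℚ.≤ x i) × (∀ S → H S → 1ℚ ℚ.≤ sumOverℚ S x)

IsVertex : ∀ {n} → Hypergraph n → Point n → Set
IsVertex H x =
  InPolyhedron H x ×
  (∀ y z (λ′ : ℚ) → InPolyhedron H y → InPolyhedron H z →
     0ℚ ℚ.< λ′ → λ′ ℚ.< 1ℚ →
     (∀ i → x i ≡ (λ′ ℚ.* y i) ℚ.+ ((1ℚ ℚ.- λ′) ℚ.* z i)) →
     ∀ i → y i ≡ z i)

IsIntegral : ∀ {n} → Point n → Set
IsIntegral x = ∀ i → ∃ λ (m : ℤ) → x i ≡ m / 1

Ideal : ∀ {n} → Hypergraph n → Set
Ideal H = ∀ x → IsVertex H x → IsIntegral x

-- integral covers x (x ≥ 0 automatic in ℕ)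
IsCover : ∀ {n} → Hypergraph n → (Fin n → ℕ) → Set
IsCover H x = ∀ S → H S → 1 ℕ.≤ sumOverℕ S x

cost : ∀ {n} → (Fin n → ℕ) → (Fin n → ℕ) → ℕ
cost {n} c x = sumOverℕ (Data.Vec.replicate n true) (λ i → c i ℕ.* x i)
  where import Data.Vec

-- dual variables y indexed by hyperedges, represented as a function on all
-- subsets that vanishes outside the hyperedges
IsPacking : ∀ {n} → Hypergraph n → (Fin n → ℕ) → (Subset n → ℕ) → Set
IsPacking {n} H c y =
  (∀ S → (H S → Data.Empty.⊥) → y S ≡ 0) ×
  (∀ v → sum (map (λ S → if lookup S v then y S else 0) (allSubsets n)) ℕ.≤ c v)
  where import Data.Empty

total : ∀ {n} → (Subset n → ℕ) → ℕ
total {n} y = sum (map y (allSubsets n))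

IsMinCover : ∀ {n} → Hypergraph n → (Fin n → ℕ) → ℕ → Set
IsMinCover H c m =
  (∃ λ x → IsCover H x × cost c x ≡ m) × (∀ x → IsCover H x → m ℕ.≤ cost c x)

IsMaxPacking : ∀ {n} → Hypergraph n → (Fin n → ℕ) → ℕ → Set
IsMaxPacking H c m =
  (∃ λ y → IsPacking H c y × total y ≡ m) × (∀ y → IsPacking H c y → total y ℕ.≤ m)

Mengerian : ∀ {n} → Hypergraph n → Set
Mengerian H = ∀ c → ∃ λ m → IsMinCover H c m × IsMaxPacking H c m

-- Every hyperedge of H₃(C_k) contains a window {a, a+1, a+2, a+3} of cyclically consecutive
-- vertices, and the windows are hyperedges, so the covering polyhedron of H₃(C_k) is cut out by
-- x ≥ 0 and the k window inequalities.  A feasible point is a vertex as soon as it is the only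
-- feasible point that is tight wherever it is tight.  For odd k the constant ¼ is such a vertex:
-- tight windows force period 4 as well as period k, hence a constant.  For k ≡ 2 (mod 4), and for
-- k ≡ 0 (mod 4) with k ≥ 12, the point equal to ½ on a suitable support is one: the tight windows
-- force consecutive support values to sum to 1 along a closed chain of odd length, so all of them
-- are ½.  For the Mengerian property, weights c on the vertices admit a fractional packing u and
-- window weights T certifying that both optima of the fractional relaxation equal N / d with
-- d ∤ N, so the integral minimum and maximum cannot coincide.
module Submission where

open import Algebra.Bundles using (CommutativeMonoid)
open import Algebra.Core using (Op₂)
import Algebra.Properties.CommutativeSemigroup as CommutativeSemigroupProperties
open import Algebra.Structures using (IsCommutativeMonoid)
open import Data.Bool using (Bool; true; false; not; if_then_else_)
open import Data.Fin using (Fin; zero; suc; toℕ)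
open import Data.Fin.Properties using (toℕ-injective; toℕ-fromℕ<; toℕ<n)
open import Data.Fin.Subset using (Subset; inside; outside; _∈_; _∉_; _⊆_; ⊥; ⊤; ⁅_⁆; _∪_; ∣_∣)
open import Data.Fin.Subset.Properties
  using (drop-∷-⊆; ∪-identityˡ; ∪-identityʳ; ∉⊥; x∈p∪q⁻; x∈p∪q⁺; x∈⁅x⁆; x∈⁅y⁆⇒x≡y; x≢y⇒x∉⁅y⁆)
import Data.Integer as ℤ
open import Data.List using (List; []; _∷_; map)
open import Data.Nat
  using (ℕ; zero; suc; _+_; _*_; _∸_; _%_; _/_; _≤_; _<_; NonZero; z≤n; s≤s; pred; _≤?_; _<?_)
open import Data.Nat.Coprimality using (1-coprimeTo) renaming (sym to coprime-sym)
open import Data.Nat.DivMod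
  using (_mod_; m%n<n; m%n%n≡m%n; %-distribˡ-+; m<n⇒m%n≡m; [m+n]%n≡m%n; m≤n⇒[n∸m]%m≡n%m; m≡m%n+[m/n]*n)
open import Data.Nat.Divisibility using (_∣_; _∣?_; divides; ∣m+n∣m⇒∣n)
open import Data.Nat.ListAction using (sum)
import Data.Nat.Properties as ℕP
import Data.Nat.Solver as ℕSolver
open import Data.Product using (∃-syntax; _×_; _,_; proj₁; proj₂)
open import Data.Rational as ℚ using (ℚ; 0ℚ; 1ℚ; ½)
import Data.Rational.Properties as ℚP
import Data.Rational.Solver as ℚSolver
open import Data.Sum using (_⊎_; inj₁; inj₂)
open import Data.Vec using ([]; _∷_; lookup; here; there)
open import Function using (_∘_; const)
open import Level using (0ℓ)
open import Relation.Binary.Core using (Rel)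
open import Relation.Binary.Definitions using (Monotonic₂)
open import Relation.Binary.PropositionalEquality
open import Relation.Binary.Structures using (IsPreorder)
open import Relation.Nullary using (¬_; yes; no; contradiction)
open import Relation.Nullary.Decidable using (True; from-yes; from-no; toWitness)
open import Defs

-- Sums over subsets

module SubsetSums {A : Set} {_∙_ : Op₂ A} {ε : A} {_≼_ : Rel A 0ℓ}
  (isCommutativeMonoid : IsCommutativeMonoid _≡_ _∙_ ε)
  (isPreorder : IsPreorder _≡_ _≼_)
  (∙-mono-≼ : Monotonic₂ _≼_ _≼_ _≼_ _∙_) where

  open IsCommutativeMonoid isCommutativeMonoid using (assoc; comm; identityˡ; identityʳ)
  open IsPreorder isPreorder using () renaming (refl to ≼-refl)

  private
    commutativeMonoid : CommutativeMonoid 0ℓ 0ℓ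
    commutativeMonoid = record { isCommutativeMonoid = isCommutativeMonoid }

  sumOver : ∀ {n} → Subset n → (Fin n → A) → A
  sumOver []            f = ε
  sumOver (inside ∷ S)  f = f zero ∙ sumOver S (f ∘ suc)
  sumOver (outside ∷ S) f = sumOver S (f ∘ suc)

  window : (ℕ → A) → ℕ → A
  window f a = f a ∙ (f (1 + a) ∙ (f (2 + a) ∙ f (3 + a)))

  window-cong : ∀ {f g : ℕ → A} → (∀ n → f n ≡ g n) → ∀ a → window f a ≡ window g a
  window-cong f≗g a = cong₂ _∙_ (f≗g a) (cong₂ _∙_ (f≗g _) (cong₂ _∙_ (f≗g _) (f≗g _)))

  sumOver-⊥ : ∀ {n} (f : Fin n → A) → sumOver ⊥ f ≡ ε
  sumOver-⊥ {zero}  f = refl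
  sumOver-⊥ {suc n} f = sumOver-⊥ (f ∘ suc)

  sumOver-zero : ∀ {n} (S : Subset n) → sumOver S (λ _ → ε) ≡ ε
  sumOver-zero []            = refl
  sumOver-zero (inside ∷ S)  = trans (identityˡ _) (sumOver-zero S)
  sumOver-zero (outside ∷ S) = sumOver-zero S

  sumOver-⁅⁆∪ : ∀ {n} (S : Subset n) i f → i ∉ S → sumOver (⁅ i ⁆ ∪ S) f ≡ f i ∙ sumOver S f
  sumOver-⁅⁆∪ (inside ∷ S)  zero    f i∉S = contradiction here i∉S
  sumOver-⁅⁆∪ (outside ∷ S) zero    f i∉S = cong (λ T → f zero ∙ sumOver T (f ∘ suc)) (∪-identityˡ S)
  sumOver-⁅⁆∪ (outside ∷ S) (suc i) f i∉S = sumOver-⁅⁆∪ S i (f ∘ suc) (i∉S ∘ there)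
  sumOver-⁅⁆∪ (inside ∷ S)  (suc i) f i∉S = begin
    f zero ∙ sumOver (⁅ i ⁆ ∪ S) (f ∘ suc)       ≡⟨ cong (f zero ∙_) (sumOver-⁅⁆∪ S i (f ∘ suc) (i∉S ∘ there)) ⟩
    f zero ∙ (f (suc i) ∙ sumOver S (f ∘ suc))   ≡⟨ assoc _ _ _ ⟨
    (f zero ∙ f (suc i)) ∙ sumOver S (f ∘ suc)   ≡⟨ cong (_∙ sumOver S (f ∘ suc)) (comm _ _) ⟩
    (f (suc i) ∙ f zero) ∙ sumOver S (f ∘ suc)   ≡⟨ assoc _ _ _ ⟩
    f (suc i) ∙ (f zero ∙ sumOver S (f ∘ suc))   ∎
    where open ≡-Reasoning

  sumOver-⁅⁆ : ∀ {n} (i : Fin n) f → sumOver ⁅ i ⁆ f ≡ f i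
  sumOver-⁅⁆ i f = begin
    sumOver ⁅ i ⁆ f        ≡⟨ cong (λ T → sumOver T f) (∪-identityʳ ⁅ i ⁆) ⟨
    sumOver (⁅ i ⁆ ∪ ⊥) f  ≡⟨ sumOver-⁅⁆∪ ⊥ i f ∉⊥ ⟩
    f i ∙ sumOver ⊥ f      ≡⟨ cong (f i ∙_) (sumOver-⊥ f) ⟩
    f i ∙ ε                ≡⟨ identityʳ (f i) ⟩
    f i                    ∎
    where open ≡-Reasoning

  sumOver-cong : ∀ {n} (S : Subset n) {f g} → (∀ i → f i ≡ g i) → sumOver S f ≡ sumOver S g
  sumOver-cong []            f≗g = refl
  sumOver-cong (inside ∷ S)  f≗g = cong₂ _∙_ (f≗g zero) (sumOver-cong S (f≗g ∘ suc))
  sumOver-cong (outside ∷ S) f≗g = sumOver-cong S (f≗g ∘ suc)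

  sumOver-mono-≼ : ∀ {n} (S : Subset n) {f g} → (∀ i → f i ≼ g i) → sumOver S f ≼ sumOver S g
  sumOver-mono-≼ []            f≼g = ≼-refl
  sumOver-mono-≼ (inside ∷ S)  f≼g = ∙-mono-≼ (f≼g zero) (sumOver-mono-≼ S (f≼g ∘ suc))
  sumOver-mono-≼ (outside ∷ S) f≼g = sumOver-mono-≼ S (f≼g ∘ suc)

  sumOver-mono-⊆ : ∀ {n} {S T : Subset n} f → (∀ i → ε ≼ f i) → S ⊆ T → sumOver S f ≼ sumOver T f
  sumOver-mono-⊆ {S = []}          {[]}          f f≥ε S⊆T = ≼-refl
  sumOver-mono-⊆ {S = inside ∷ S}  {inside ∷ T}  f f≥ε S⊆T =
    ∙-mono-≼ ≼-refl (sumOver-mono-⊆ (f ∘ suc) (f≥ε ∘ suc) (drop-∷-⊆ S⊆T))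
  sumOver-mono-⊆ {S = inside ∷ S}  {outside ∷ T} f f≥ε S⊆T with S⊆T here
  ... | ()
  sumOver-mono-⊆ {S = outside ∷ S} {inside ∷ T}  f f≥ε S⊆T =
    subst (_≼ _) (identityˡ _) (∙-mono-≼ (f≥ε zero) (sumOver-mono-⊆ (f ∘ suc) (f≥ε ∘ suc) (drop-∷-⊆ S⊆T)))
  sumOver-mono-⊆ {S = outside ∷ S} {outside ∷ T} f f≥ε S⊆T =
    sumOver-mono-⊆ (f ∘ suc) (f≥ε ∘ suc) (drop-∷-⊆ S⊆T)

  sumOver-distrib : ∀ {n} (S : Subset n) f g → sumOver S (λ i → f i ∙ g i) ≡ sumOver S f ∙ sumOver S g
  sumOver-distrib []            f g = sym (identityˡ ε)
  sumOver-distrib (inside ∷ S)  f g =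
    trans (cong ((f zero ∙ g zero) ∙_) (sumOver-distrib S (f ∘ suc) (g ∘ suc))) (interchange (f zero) (g zero) _ _)
    where open CommutativeSemigroupProperties (CommutativeMonoid.commutativeSemigroup commutativeMonoid)
  sumOver-distrib (outside ∷ S) f g = sumOver-distrib S (f ∘ suc) (g ∘ suc)

module ℚΣ = SubsetSums ℚP.+-0-isCommutativeMonoid ℚP.≤-isPreorder ℚP.+-mono-≤
module ℕΣ = SubsetSums ℕP.+-0-isCommutativeMonoid ℕP.≤-isPreorder ℕP.+-mono-≤

sumOverℚ≡sumOver : ∀ {n} (S : Subset n) f → sumOverℚ S f ≡ ℚΣ.sumOver S f
sumOverℚ≡sumOver []            f = refl
sumOverℚ≡sumOver (inside ∷ S)  f = cong (f zero ℚ.+_) (sumOverℚ≡sumOver S (f ∘ suc))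
sumOverℚ≡sumOver (outside ∷ S) f = sumOverℚ≡sumOver S (f ∘ suc)

sumOverℕ≡sumOver : ∀ {n} (S : Subset n) f → sumOverℕ S f ≡ ℕΣ.sumOver S f
sumOverℕ≡sumOver []            f = refl
sumOverℕ≡sumOver (inside ∷ S)  f = cong (f zero +_) (sumOverℕ≡sumOver S (f ∘ suc))
sumOverℕ≡sumOver (outside ∷ S) f = sumOverℕ≡sumOver S (f ∘ suc)

∣S∣≡sumOver-1 : ∀ {n} (S : Subset n) → ∣ S ∣ ≡ ℕΣ.sumOver S (const 1)
∣S∣≡sumOver-1 []            = refl
∣S∣≡sumOver-1 (inside ∷ S)  = cong suc (∣S∣≡sumOver-1 S)
∣S∣≡sumOver-1 (outside ∷ S) = ∣S∣≡sumOver-1 S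

∉-⁅⁆∪ : ∀ {n} {x y : Fin n} {S} → x ≢ y → x ∉ S → x ∉ ⁅ y ⁆ ∪ S
∉-⁅⁆∪ {y = y} {S} x≢y x∉S x∈ with x∈p∪q⁻ ⁅ y ⁆ S x∈
... | inj₁ x∈⁅y⁆ = x≢y⇒x∉⁅y⁆ x≢y x∈⁅y⁆
... | inj₂ x∈S   = x∉S x∈S

-- Arithmetic on the cycle

module CycleArithmetic (k : ℕ) .{{_ : NonZero k}} where

  toℕ-mod : ∀ n → toℕ (n mod k) ≡ n % k
  toℕ-mod n = toℕ-fromℕ< (m%n<n n k)

  %⇒mod : ∀ {m n} → m % k ≡ n % k → m mod k ≡ n mod k
  %⇒mod {m} {n} eq = toℕ-injective (trans (toℕ-mod m) (trans eq (sym (toℕ-mod n))))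

  toℕ-mod-toℕ : ∀ (i : Fin k) → toℕ i mod k ≡ i
  toℕ-mod-toℕ i = toℕ-injective (trans (toℕ-mod (toℕ i)) (m<n⇒m%n≡m (toℕ<n i)))

  +%-absorbʳ : ∀ m n → (m + n % k) % k ≡ (m + n) % k
  +%-absorbʳ m n = begin
    (m + n % k) % k           ≡⟨ %-distribˡ-+ m (n % k) k ⟩
    (m % k + n % k % k) % k   ≡⟨ cong (λ t → (m % k + t) % k) (m%n%n≡m%n n k) ⟩
    (m % k + n % k) % k       ≡⟨ %-distribˡ-+ m n k ⟨
    (m + n) % k               ∎
    where open ≡-Reasoning

  +-mod-toℕʳ : ∀ m n → (m + toℕ (n mod k)) mod k ≡ (m + n) mod k
  +-mod-toℕʳ m n = %⇒mod (trans (cong (λ t → (m + t) % k) (toℕ-mod n)) (+%-absorbʳ m n))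

  +-mod-toℕˡ : ∀ m n → (toℕ (m mod k) + n) mod k ≡ (m + n) mod k
  +-mod-toℕˡ m n = trans (cong (_mod k) (ℕP.+-comm (toℕ (m mod k)) n))
                    (trans (+-mod-toℕʳ n m) (cong (_mod k) (ℕP.+-comm n m)))

  mod-periodic : ∀ n → (n + k) mod k ≡ n mod k
  mod-periodic n = %⇒mod ([m+n]%n≡m%n n k)

  %-shift-≢ : ∀ d b → 0 < d → d < k → (d + b) % k ≢ b % k
  %-shift-≢ d b 0<d d<k eq with k ≤? d + b % k
  ... | no  d+r≱k = ℕP.<⇒≢ (ℕP.m<n+m (b % k) 0<d)
                      (trans (sym (trans (+%-absorbʳ d b) eq)) (m<n⇒m%n≡m (ℕP.≰⇒> d+r≱k)))
  ... | yes k≤d+r = ℕP.<⇒≢ wrapped<r (trans (sym (m<n⇒m%n≡m wrapped<k)) wrapped%k≡r)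
    where
    r = b % k
    wrapped = d + r ∸ k
    wrapped+k≡d+r : wrapped + k ≡ d + r
    wrapped+k≡d+r = ℕP.m∸n+n≡m k≤d+r
    wrapped<r : wrapped < r
    wrapped<r = ℕP.+-cancelʳ-< k wrapped r (subst (_< r + k) (sym wrapped+k≡d+r)
                  (subst (d + r <_) (ℕP.+-comm k r) (ℕP.+-monoˡ-< r d<k)))
    wrapped<k : wrapped < k
    wrapped<k = ℕP.+-cancelʳ-< k wrapped k (subst (_< k + k) (sym wrapped+k≡d+r) (ℕP.+-mono-< d<k (m%n<n b k)))
    wrapped%k≡r : wrapped % k ≡ r
    wrapped%k≡r = trans (m≤n⇒[n∸m]%m≡n%m k≤d+r) (trans (+%-absorbʳ d b) eq)

  mod-shift-≢ : ∀ d b → 0 < d → d < k → (d + b) mod k ≢ b mod k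
  mod-shift-≢ d b 0<d d<k eq =
    %-shift-≢ d b 0<d d<k (trans (sym (toℕ-mod (d + b))) (trans (cong toℕ eq) (toℕ-mod b)))

  next : Fin k → Fin k
  next i = suc (toℕ i) mod k

  next-mod : ∀ n → next (n mod k) ≡ suc n mod k
  next-mod n = +-mod-toℕʳ 1 n

  next-injective : ∀ {i j} → next i ≡ next j → i ≡ j
  next-injective {i} {j} eq = trans (sym (prev-next i)) (trans (cong (λ t → (toℕ t + pred k) mod k) eq) (prev-next j))
    where
    prev-next : ∀ i → (toℕ (next i) + pred k) mod k ≡ i
    prev-next i = begin
      (toℕ (next i) + pred k) mod k  ≡⟨ +-mod-toℕˡ (suc (toℕ i)) (pred k) ⟩
      (suc (toℕ i) + pred k) mod k   ≡⟨ cong (_mod k) (ℕP.+-suc (toℕ i) (pred k)) ⟨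
      (toℕ i + suc (pred k)) mod k   ≡⟨ cong (λ t → (toℕ i + t) mod k) (ℕP.suc-pred k) ⟩
      (toℕ i + k) mod k              ≡⟨ mod-periodic (toℕ i) ⟩
      toℕ i mod k                    ≡⟨ toℕ-mod-toℕ i ⟩
      i                              ∎
      where open ≡-Reasoning

  Adj⇒next : ∀ {i j} → Adj (Cycle k) i j → j ≡ next i ⊎ i ≡ next j
  Adj⇒next (inj₁ eq) = inj₁ (toℕ-injective (trans eq (sym (toℕ-mod _))))
  Adj⇒next (inj₂ eq) = inj₂ (toℕ-injective (trans eq (sym (toℕ-mod _))))

  Adj-next : ∀ i → Adj (Cycle k) i (next i)
  Adj-next i = inj₁ (toℕ-mod _)

  Consecutive : ℕ → Fin k → Fin k → Fin k → Fin k → Set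
  Consecutive a v₁ v₂ v₃ v₄ = v₁ ≡ a mod k × v₂ ≡ (1 + a) mod k × v₃ ≡ (2 + a) mod k × v₄ ≡ (3 + a) mod k

  path-consecutive : ∀ {v₁ v₂ v₃ v₄} → v₁ ≢ v₃ → v₂ ≢ v₄ →
    Adj (Cycle k) v₁ v₂ → Adj (Cycle k) v₂ v₃ → Adj (Cycle k) v₃ v₄ →
    ∃[ a ] (Consecutive a v₁ v₂ v₃ v₄ ⊎ Consecutive a v₄ v₃ v₂ v₁)
  path-consecutive {v₁} {v₂} {v₃} {v₄} v₁≢v₃ v₂≢v₄ a₁₂ a₂₃ a₃₄
    with Adj⇒next a₁₂ | Adj⇒next a₂₃ | Adj⇒next a₃₄
  ... | inj₁ e₁₂ | inj₁ e₂₃ | inj₁ e₃₄ = toℕ v₁ , inj₁ (sym (toℕ-mod-toℕ v₁) , e₁₂ , e₃ , e₄)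
    where
    e₃ = trans e₂₃ (trans (cong next e₁₂) (next-mod _))
    e₄ = trans e₃₄ (trans (cong next e₃) (next-mod _))
  ... | inj₂ e₁₂ | inj₂ e₂₃ | inj₂ e₃₄ = toℕ v₄ , inj₂ (sym (toℕ-mod-toℕ v₄) , e₃₄ , e₂ , e₁)
    where
    e₂ = trans e₂₃ (trans (cong next e₃₄) (next-mod _))
    e₁ = trans e₁₂ (trans (cong next e₂) (next-mod _))
  ... | inj₁ e₁₂ | inj₂ e₂₃ | _        = contradiction (next-injective (trans (sym e₁₂) e₂₃)) v₁≢v₃
  ... | inj₂ e₁₂ | inj₁ e₂₃ | _        = contradiction (trans e₁₂ (sym e₂₃)) v₁≢v₃
  ... | _        | inj₁ e₂₃ | inj₂ e₃₄ = contradiction (next-injective (trans (sym e₂₃) e₃₄)) v₂≢v₄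
  ... | _        | inj₂ e₂₃ | inj₁ e₃₄ = contradiction (trans e₂₃ (sym e₃₄)) v₂≢v₄

  windowSet : ℕ → Subset k
  windowSet a = ⁅ a mod k ⁆ ∪ (⁅ (1 + a) mod k ⁆ ∪ (⁅ (2 + a) mod k ⁆ ∪ ⁅ (3 + a) mod k ⁆))

  windowSet-members : ∀ a → a mod k ∈ windowSet a × (1 + a) mod k ∈ windowSet a ×
                            (2 + a) mod k ∈ windowSet a × (3 + a) mod k ∈ windowSet a
  windowSet-members a =
    x∈p∪q⁺ (inj₁ (x∈⁅x⁆ _)) ,
    x∈p∪q⁺ (inj₂ (x∈p∪q⁺ (inj₁ (x∈⁅x⁆ _)))) ,
    x∈p∪q⁺ (inj₂ (x∈p∪q⁺ (inj₂ (x∈p∪q⁺ (inj₁ (x∈⁅x⁆ _)))))) ,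
    x∈p∪q⁺ (inj₂ (x∈p∪q⁺ (inj₂ (x∈p∪q⁺ (inj₂ (x∈⁅x⁆ _))))))

  windowSet-⊆ : ∀ {a v₁ v₂ v₃ v₄} {S : Subset k} → Consecutive a v₁ v₂ v₃ v₄ →
    v₁ ∈ S → v₂ ∈ S → v₃ ∈ S → v₄ ∈ S → windowSet a ⊆ S
  windowSet-⊆ {a} (refl , refl , refl , refl) v₁∈S v₂∈S v₃∈S v₄∈S x∈W
    with x∈p∪q⁻ ⁅ a mod k ⁆ _ x∈W
  ... | inj₁ x∈⁅v₁⁆ = subst (_∈ _) (sym (x∈⁅y⁆⇒x≡y _ x∈⁅v₁⁆)) v₁∈S
  ... | inj₂ x∈W₁ with x∈p∪q⁻ ⁅ (1 + a) mod k ⁆ _ x∈W₁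
  ... | inj₁ x∈⁅v₂⁆ = subst (_∈ _) (sym (x∈⁅y⁆⇒x≡y _ x∈⁅v₂⁆)) v₂∈S
  ... | inj₂ x∈W₂ with x∈p∪q⁻ ⁅ (2 + a) mod k ⁆ _ x∈W₂
  ... | inj₁ x∈⁅v₃⁆ = subst (_∈ _) (sym (x∈⁅y⁆⇒x≡y _ x∈⁅v₃⁆)) v₃∈S
  ... | inj₂ x∈⁅v₄⁆ = subst (_∈ _) (sym (x∈⁅y⁆⇒x≡y _ x∈⁅v₄⁆)) v₄∈S

  hyperedge-⊇-windowSet : ∀ {S} → H3 (Cycle k) S → ∃[ a ] windowSet a ⊆ S
  hyperedge-⊇-windowSet (_ , v₁ , v₂ , v₃ , v₄ , (v₁∈S , v₂∈S , v₃∈S , v₄∈S) ,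
                         (_ , v₁≢v₃ , _ , _ , v₂≢v₄ , _) , (a₁₂ , a₂₃ , a₃₄))
    with path-consecutive v₁≢v₃ v₂≢v₄ a₁₂ a₂₃ a₃₄
  ... | a , inj₁ c = a , windowSet-⊆ c v₁∈S v₂∈S v₃∈S v₄∈S
  ... | a , inj₂ c = a , windowSet-⊆ c v₄∈S v₃∈S v₂∈S v₁∈S

module CycleWindows (k : ℕ) .{{_ : NonZero k}} (4≤k : 4 ≤ k) where

  open CycleArithmetic k public

  shift-≢ : ∀ d b → 0 < d → d < 4 → b mod k ≢ (d + b) mod k
  shift-≢ d b 0<d d<4 = ≢-sym (mod-shift-≢ d b 0<d (ℕP.<-≤-trans d<4 4≤k))

  shift-≢₁ : ∀ b → b mod k ≢ (1 + b) mod k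
  shift-≢₁ b = shift-≢ 1 b (s≤s z≤n) (s≤s (s≤s z≤n))

  shift-≢₂ : ∀ b → b mod k ≢ (2 + b) mod k
  shift-≢₂ b = shift-≢ 2 b (s≤s z≤n) (s≤s (s≤s (s≤s z≤n)))

  shift-≢₃ : ∀ b → b mod k ≢ (3 + b) mod k
  shift-≢₃ b = shift-≢ 3 b (s≤s z≤n) (s≤s (s≤s (s≤s (s≤s z≤n))))

  module Sums {A : Set} {_∙_ : Op₂ A} {ε : A} {_≼_ : Rel A 0ℓ}
    (isCommutativeMonoid : IsCommutativeMonoid _≡_ _∙_ ε)
    (isPreorder : IsPreorder _≡_ _≼_)
    (∙-mono-≼ : Monotonic₂ _≼_ _≼_ _≼_ _∙_) where

    open SubsetSums isCommutativeMonoid isPreorder ∙-mono-≼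

    sumOver-windowSet : ∀ a f → sumOver (windowSet a) f ≡ window (f ∘ (_mod k)) a
    sumOver-windowSet a f = begin
      sumOver (windowSet a) f
        ≡⟨ sumOver-⁅⁆∪ _ _ f (∉-⁅⁆∪ (shift-≢₁ a) (∉-⁅⁆∪ (shift-≢₂ a) (x≢y⇒x∉⁅y⁆ (shift-≢₃ a)))) ⟩
      f (a mod k) ∙ sumOver (⁅ (1 + a) mod k ⁆ ∪ (⁅ (2 + a) mod k ⁆ ∪ ⁅ (3 + a) mod k ⁆)) f
        ≡⟨ cong (f (a mod k) ∙_) (sumOver-⁅⁆∪ _ _ f (∉-⁅⁆∪ (shift-≢₁ (1 + a)) (x≢y⇒x∉⁅y⁆ (shift-≢₂ (1 + a))))) ⟩
      f (a mod k) ∙ (f ((1 + a) mod k) ∙ sumOver (⁅ (2 + a) mod k ⁆ ∪ ⁅ (3 + a) mod k ⁆) f)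
        ≡⟨ cong (λ t → f (a mod k) ∙ (f ((1 + a) mod k) ∙ t))
             (trans (sumOver-⁅⁆∪ _ _ f (x≢y⇒x∉⁅y⁆ (shift-≢₁ (2 + a)))) (cong (f ((2 + a) mod k) ∙_) (sumOver-⁅⁆ _ f))) ⟩
      window (f ∘ (_mod k)) a ∎
      where open ≡-Reasoning

    window≼sumOver-hyperedge : ∀ {S} f → (∀ i → ε ≼ f i) → H3 (Cycle k) S →
      ∃[ a ] window (f ∘ (_mod k)) a ≼ sumOver S f
    window≼sumOver-hyperedge f f≥ε e with hyperedge-⊇-windowSet e
    ... | a , W⊆S = a , subst (_≼ _) (sumOver-windowSet a f) (sumOver-mono-⊆ f f≥ε W⊆S)

  module ℚW = Sums ℚP.+-0-isCommutativeMonoid ℚP.≤-isPreorder ℚP.+-mono-≤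
  module ℕW = Sums ℕP.+-0-isCommutativeMonoid ℕP.≤-isPreorder ℕP.+-mono-≤

  windowSet-hyperedge : ∀ a → H3 (Cycle k) (windowSet a)
  windowSet-hyperedge a =
    trans (∣S∣≡sumOver-1 (windowSet a)) (ℕW.sumOver-windowSet a (const 1)) ,
    a mod k , (1 + a) mod k , (2 + a) mod k , (3 + a) mod k ,
    windowSet-members a ,
    (shift-≢₁ a , shift-≢₂ a , shift-≢₃ a , shift-≢₁ (1 + a) , shift-≢₂ (1 + a) , shift-≢₁ (2 + a)) ,
    (step a , step (1 + a) , step (2 + a))
    where
    step : ∀ b → Adj (Cycle k) (b mod k) ((1 + b) mod k)
    step b = subst (Adj (Cycle k) (b mod k)) (next-mod b) (Adj-next (b mod k))

-- Vertices of the covering polyhedron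

↧ₙ-/1 : ∀ m → ℚ.↧ₙ (m ℚ./ 1) ≡ 1
↧ₙ-/1 (ℤ.+ n)    = cong ℚ.↧ₙ_ (ℚP.normalize-coprime (coprime-sym (1-coprimeTo n)))
↧ₙ-/1 ℤ.-[1+ n ] = cong (ℚ.↧ₙ_ ∘ ℚ.-_) (ℚP.normalize-coprime (coprime-sym (1-coprimeTo (suc n))))

nonIntegral : ∀ {q} → ℚ.↧ₙ q ≢ 1 → ∀ m → q ≢ m ℚ./ 1
nonIntegral ↧q≢1 m q≡m = ↧q≢1 (trans (cong ℚ.↧ₙ_ q≡m) (↧ₙ-/1 m))

module _ where
  open ℚSolver.+-*-Solver

  0<1-λ : ∀ {λ′} → λ′ ℚ.< 1ℚ → 0ℚ ℚ.< 1ℚ ℚ.- λ′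
  0<1-λ {λ′} λ′<1 = subst (ℚ._< 1ℚ ℚ.- λ′) (solve 1 (λ l → l :- l := con 0ℚ) refl λ′) (ℚP.+-monoˡ-< (ℚ.- λ′) λ′<1)

  convex-tightˡ : ∀ {λ′ a b t} → 0ℚ ℚ.< λ′ → λ′ ℚ.< 1ℚ → t ℚ.≤ a → t ℚ.≤ b →
    λ′ ℚ.* a ℚ.+ (1ℚ ℚ.- λ′) ℚ.* b ≡ t → a ≡ t
  convex-tightˡ {λ′} {a} {b} {t} 0<λ λ<1 t≤a t≤b comb = ℚP.≤-antisym a≤t t≤a
    where
    instance
      _ : ℚ.Positive λ′
      _ = ℚ.positive 0<λ
      _ : ℚ.NonNegative (1ℚ ℚ.- λ′)
      _ = ℚ.nonNegative (ℚP.<⇒≤ (0<1-λ λ<1))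
    μ = 1ℚ ℚ.- λ′
    λa+μt≤λt+μt : λ′ ℚ.* a ℚ.+ μ ℚ.* t ℚ.≤ λ′ ℚ.* t ℚ.+ μ ℚ.* t
    λa+μt≤λt+μt = subst (λ′ ℚ.* a ℚ.+ μ ℚ.* t ℚ.≤_)
                    (trans comb (solve 2 (λ l t → t := l :* t :+ (con 1ℚ :- l) :* t) refl λ′ t))
                    (ℚP.+-monoʳ-≤ (λ′ ℚ.* a) (ℚP.*-monoˡ-≤-nonNeg μ t≤b))
    cancel : ∀ u → u ℚ.+ μ ℚ.* t ℚ.- μ ℚ.* t ≡ u
    cancel u = solve 2 (λ u w → u :+ w :- w := u) refl u (μ ℚ.* t)
    a≤t : a ℚ.≤ t
    a≤t = ℚP.*-cancelˡ-≤-pos λ′ (subst₂ ℚ._≤_ (cancel (λ′ ℚ.* a)) (cancel (λ′ ℚ.* t))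
            (ℚP.+-monoˡ-≤ (ℚ.- (μ ℚ.* t)) λa+μt≤λt+μt))

  convex-tight : ∀ {λ′ a b t} → 0ℚ ℚ.< λ′ → λ′ ℚ.< 1ℚ → t ℚ.≤ a → t ℚ.≤ b →
    λ′ ℚ.* a ℚ.+ (1ℚ ℚ.- λ′) ℚ.* b ≡ t → a ≡ t × b ≡ t
  convex-tight {λ′} {a} {b} 0<λ λ<1 t≤a t≤b comb =
    convex-tightˡ 0<λ λ<1 t≤a t≤b comb ,
    convex-tightˡ (0<1-λ λ<1) 1-λ<1 t≤b t≤a
      (trans (solve 3 (λ l a b → (con 1ℚ :- l) :* b :+ (con 1ℚ :- (con 1ℚ :- l)) :* a
                                 := l :* a :+ (con 1ℚ :- l) :* b) refl λ′ a b) comb)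
    where
    1-λ<1 : 1ℚ ℚ.- λ′ ℚ.< 1ℚ
    1-λ<1 = subst₂ ℚ._<_ (solve 1 (λ l → con 0ℚ :+ (con 1ℚ :- l) := con 1ℚ :- l) refl λ′)
                         (solve 1 (λ l → l :+ (con 1ℚ :- l) := con 1ℚ) refl λ′)
                         (ℚP.+-monoˡ-< (1ℚ ℚ.- λ′) 0<λ)

  window-convex : ∀ λ′ {x y z : ℕ → ℚ} → (∀ n → x n ≡ λ′ ℚ.* y n ℚ.+ (1ℚ ℚ.- λ′) ℚ.* z n) →
    ∀ a → ℚΣ.window x a ≡ λ′ ℚ.* ℚΣ.window y a ℚ.+ (1ℚ ℚ.- λ′) ℚ.* ℚΣ.window z a
  window-convex λ′ {x} {y} {z} x≡ a = trans (ℚΣ.window-cong x≡ a)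
    (solve 9 (λ l y₀ y₁ y₂ y₃ z₀ z₁ z₂ z₃ →
        (l :* y₀ :+ (con 1ℚ :- l) :* z₀) :+ ((l :* y₁ :+ (con 1ℚ :- l) :* z₁) :+
          ((l :* y₂ :+ (con 1ℚ :- l) :* z₂) :+ (l :* y₃ :+ (con 1ℚ :- l) :* z₃)))
        := l :* (y₀ :+ (y₁ :+ (y₂ :+ y₃))) :+ (con 1ℚ :- l) :* (z₀ :+ (z₁ :+ (z₂ :+ z₃))))
      refl λ′ (y a) (y (1 + a)) (y (2 + a)) (y (3 + a)) (z a) (z (1 + a)) (z (2 + a)) (z (3 + a)))

module CycleVertices (k : ℕ) .{{_ : NonZero k}} (4≤k : 4 ≤ k) where

  open CycleWindows k 4≤k

  W : (Fin k → ℚ) → ℕ → ℚ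
  W x = ℚΣ.window (x ∘ (_mod k))

  WindowFeasible : (Fin k → ℚ) → Set
  WindowFeasible x = (∀ i → 0ℚ ℚ.≤ x i) × (∀ a → 1ℚ ℚ.≤ W x a)

  InPolyhedron⇒WindowFeasible : ∀ {x} → InPolyhedron (H3 (Cycle k)) x → WindowFeasible x
  InPolyhedron⇒WindowFeasible {x} (x≥0 , covers) = x≥0 , λ a →
    subst (1ℚ ℚ.≤_) (trans (sumOverℚ≡sumOver (windowSet a) x) (ℚW.sumOver-windowSet a x))
      (covers _ (windowSet-hyperedge a))

  WindowFeasible⇒InPolyhedron : ∀ {x} → WindowFeasible x → InPolyhedron (H3 (Cycle k)) x
  WindowFeasible⇒InPolyhedron {x} (x≥0 , W≥1) = x≥0 , λ S e →
    let (a , Wₐ≤ΣS) = ℚW.window≼sumOver-hyperedge x x≥0 e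
    in subst (1ℚ ℚ.≤_) (sym (sumOverℚ≡sumOver S x)) (ℚP.≤-trans (W≥1 a) Wₐ≤ΣS)

  TightnessDetermines : (Fin k → ℚ) → Set
  TightnessDetermines x = ∀ y → WindowFeasible y →
    (∀ i → x i ≡ 0ℚ → y i ≡ 0ℚ) → (∀ a → W x a ≡ 1ℚ → W y a ≡ 1ℚ) → ∀ i → y i ≡ x i

  isVertex : ∀ {x} → WindowFeasible x → TightnessDetermines x → IsVertex (H3 (Cycle k)) x
  isVertex {x} feasible determines = WindowFeasible⇒InPolyhedron feasible , splits
    where
    splits : ∀ y z λ′ → InPolyhedron (H3 (Cycle k)) y → InPolyhedron (H3 (Cycle k)) z →
      0ℚ ℚ.< λ′ → λ′ ℚ.< 1ℚ → (∀ i → x i ≡ λ′ ℚ.* y i ℚ.+ (1ℚ ℚ.- λ′) ℚ.* z i) → ∀ i → y i ≡ z i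
    splits y z λ′ y∈P z∈P 0<λ λ<1 x≡ i = trans (y≡x i) (sym (z≡x i))
      where
      fy = InPolyhedron⇒WindowFeasible y∈P
      fz = InPolyhedron⇒WindowFeasible z∈P
      tight-coord : ∀ i → x i ≡ 0ℚ → y i ≡ 0ℚ × z i ≡ 0ℚ
      tight-coord i xᵢ≡0 = convex-tight 0<λ λ<1 (proj₁ fy i) (proj₁ fz i) (trans (sym (x≡ i)) xᵢ≡0)
      tight-window : ∀ a → W x a ≡ 1ℚ → W y a ≡ 1ℚ × W z a ≡ 1ℚ
      tight-window a Wxₐ≡1 = convex-tight 0<λ λ<1 (proj₂ fy a) (proj₂ fz a)
        (trans (sym (window-convex λ′ (x≡ ∘ (_mod k)) a)) Wxₐ≡1)
      y≡x = determines y fy (λ i → proj₁ ∘ tight-coord i) (λ a → proj₁ ∘ tight-window a)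
      z≡x = determines z fz (λ i → proj₂ ∘ tight-coord i) (λ a → proj₂ ∘ tight-window a)

  ¬Ideal : ∀ {x} → WindowFeasible x → TightnessDetermines x →
    ∀ i → (∀ m → x i ≢ m ℚ./ 1) → ¬ Ideal (H3 (Cycle k))
  ¬Ideal feasible determines i xᵢ-nonIntegral ideal =
    let (m , xᵢ≡m) = ideal _ (isVertex feasible determines) i in xᵢ-nonIntegral m xᵢ≡m

-- Sums over ranges and periodic functions

sumBelow : ℕ → (ℕ → ℕ) → ℕ
sumBelow n g = ℕΣ.sumOver (⊤ {n}) (g ∘ toℕ)

sumBelow-snoc : ∀ n g → sumBelow (suc n) g ≡ sumBelow n g + g n
sumBelow-snoc zero    g = ℕP.+-comm (g 0) 0
sumBelow-snoc (suc n) g = trans (cong (g 0 +_) (sumBelow-snoc n (g ∘ suc))) (sym (ℕP.+-assoc (g 0) _ _))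

sumBelow-cong : ∀ n {f g} → (∀ b → b < n → f b ≡ g b) → sumBelow n f ≡ sumBelow n g
sumBelow-cong n f≗g = ℕΣ.sumOver-cong (⊤ {n}) (λ i → f≗g (toℕ i) (toℕ<n i))

sumBelow-mono-≤ : ∀ n {f g} → (∀ b → b < n → f b ≤ g b) → sumBelow n f ≤ sumBelow n g
sumBelow-mono-≤ n f≤g = ℕΣ.sumOver-mono-≼ (⊤ {n}) (λ i → f≤g (toℕ i) (toℕ<n i))

sumBelow-distrib-+ : ∀ n f g → sumBelow n (λ b → f b + g b) ≡ sumBelow n f + sumBelow n g
sumBelow-distrib-+ n f g = ℕΣ.sumOver-distrib (⊤ {n}) (f ∘ toℕ) (g ∘ toℕ)

sumBelow-distribˡ-* : ∀ n m f → sumBelow n (λ b → m * f b) ≡ m * sumBelow n f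
sumBelow-distribˡ-* zero    m f = sym (ℕP.*-zeroʳ m)
sumBelow-distribˡ-* (suc n) m f = trans (cong (m * f 0 +_) (sumBelow-distribˡ-* n m (f ∘ suc)))
                                        (sym (ℕP.*-distribˡ-+ m (f 0) _))

sumBelow-1 : ∀ n → sumBelow n (const 1) ≡ n
sumBelow-1 zero    = refl
sumBelow-1 (suc n) = cong suc (sumBelow-1 n)

Periodic : {A : Set} → ℕ → (ℕ → A) → Set
Periodic p f = ∀ n → f (n + p) ≡ f n

Periodic-∘suc : ∀ {A : Set} {p} {f : ℕ → A} → Periodic p f → Periodic p (f ∘ suc)
Periodic-∘suc per n = per (suc n)

Periodic-* : ∀ {A : Set} {p} {f : ℕ → A} → Periodic p f → ∀ m → Periodic (m * p) f
Periodic-*         {f = f} per zero    n = cong f (ℕP.+-identityʳ n)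
Periodic-* {p = p} {f = f} per (suc m) n =
  trans (cong f (sym (ℕP.+-assoc n p (m * p)))) (trans (Periodic-* per m (n + p)) (per n))

Periodic-reduce : ∀ {A : Set} {p} {f : ℕ → A} → Periodic p f → ∀ r m → Periodic (r + m * p) f → Periodic r f
Periodic-reduce {p = p} {f} per r m per′ n =
  trans (sym (Periodic-* per m (n + r))) (trans (cong f (ℕP.+-assoc n r (m * p))) (per′ n))

Periodic1⇒constant : ∀ {A : Set} {f : ℕ → A} → Periodic 1 f → ∀ n → f n ≡ f 0
Periodic1⇒constant         per zero    = refl
Periodic1⇒constant {f = f} per (suc n) = trans (cong f (ℕP.+-comm 1 n)) (trans (per n) (Periodic1⇒constant per n))

Periodic⇒%-invariant : ∀ {A : Set} {k} .{{_ : NonZero k}} {f : ℕ → A} → Periodic k f → ∀ n → f (n % k) ≡ f n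
Periodic⇒%-invariant {k = k} {f} per n =
  trans (sym (Periodic-* per (n / k) (n % k))) (cong f (sym (m≡m%n+[m/n]*n n k)))

%-wrap : ∀ {A : Set} {k} .{{_ : NonZero k}} (f : ℕ → A) s → s ≤ k → (∀ r → r < s → f (r + k) ≡ f r) →
  ∀ n → n < s + k → f (n % k) ≡ f n
%-wrap {k = k} f s s≤k wraps n n<s+k with n <? k
... | yes n<k = cong f (m<n⇒m%n≡m n<k)
... | no  n≮k = begin
  f (n % k)    ≡⟨ cong f (trans (cong (_% k) (sym r+k≡n)) ([m+n]%n≡m%n r k)) ⟩
  f (r % k)    ≡⟨ cong f (m<n⇒m%n≡m (ℕP.<-≤-trans r<s s≤k)) ⟩
  f r          ≡⟨ wraps r r<s ⟨
  f (r + k)    ≡⟨ cong f r+k≡n ⟩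
  f n          ∎
  where
  open ≡-Reasoning
  r = n ∸ k
  r+k≡n : r + k ≡ n
  r+k≡n = ℕP.m∸n+n≡m (ℕP.≮⇒≥ n≮k)
  r<s : r < s
  r<s = ℕP.+-cancelʳ-< k r s (subst (_< s + k) (sym r+k≡n) n<s+k)

window-periodic : ∀ {p} {f : ℕ → ℕ} → Periodic p f → Periodic p (ℕΣ.window f)
window-periodic per n = cong₂ _+_ (per n) (cong₂ _+_ (per (1 + n)) (cong₂ _+_ (per (2 + n)) (per (3 + n))))

sumBelow-rotate₁ : ∀ {n g} → Periodic n g → sumBelow n (g ∘ suc) ≡ sumBelow n g
sumBelow-rotate₁ {zero}      per = refl
sumBelow-rotate₁ {suc n} {g} per =
  trans (sumBelow-snoc n (g ∘ suc)) (trans (cong (sumBelow n (g ∘ suc) +_) (per 0)) (ℕP.+-comm _ (g 0)))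

sumBelow-rotate : ∀ {n g} → Periodic n g → ∀ t → sumBelow n (λ a → g (t + a)) ≡ sumBelow n g
sumBelow-rotate per zero    = refl
sumBelow-rotate per (suc t) = trans (sumBelow-rotate (Periodic-∘suc per) t) (sumBelow-rotate₁ per)

-- Window a contains b iff a ∈ {b - 3, …, b}; the offset 3 keeps the indices free of truncated
-- subtraction.
module _ {k} {T X : ℕ → ℕ} (T-periodic : Periodic k T) (X-periodic : Periodic k X) where
  open ℕSolver.+-*-Solver

  private
    shifted : ℕ → ℕ → ℕ
    shifted s a = T (s + a) * X a

    shifted-periodic : ∀ s → Periodic k (shifted s)
    shifted-periodic s n = cong₂ _*_ (trans (cong T (sym (ℕP.+-assoc s n k))) (T-periodic (s + n))) (X-periodic n)

    distrib₄ : ∀ f g h i → sumBelow k (λ a → f a + (g a + (h a + i a))) ≡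
                           sumBelow k f + (sumBelow k g + (sumBelow k h + sumBelow k i))
    distrib₄ f g h i =
      trans (sumBelow-distrib-+ k f (λ a → g a + (h a + i a))) (cong (sumBelow k f +_)
        (trans (sumBelow-distrib-+ k g (λ a → h a + i a)) (cong (sumBelow k g +_) (sumBelow-distrib-+ k h i))))

  sumBelow-window-adjoint :
    sumBelow k (λ a → T (3 + a) * ℕΣ.window X a) ≡ sumBelow k (λ a → ℕΣ.window T a * X a)
  sumBelow-window-adjoint = begin
    sumBelow k (λ a → T (3 + a) * ℕΣ.window X a)
      ≡⟨ sumBelow-cong k (λ a _ → solve 5 (λ t x₀ x₁ x₂ x₃ → t :* (x₀ :+ (x₁ :+ (x₂ :+ x₃)))
                                      := t :* x₀ :+ (t :* x₁ :+ (t :* x₂ :+ t :* x₃))) refl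
                                    (T (3 + a)) (X a) (X (1 + a)) (X (2 + a)) (X (3 + a))) ⟩
    sumBelow k (λ a → shifted 3 a + (shifted 2 (1 + a) + (shifted 1 (2 + a) + shifted 0 (3 + a))))
      ≡⟨ distrib₄ (shifted 3) (shifted 2 ∘ (1 +_)) (shifted 1 ∘ (2 +_)) (shifted 0 ∘ (3 +_)) ⟩
    sumBelow k (shifted 3) + (sumBelow k (λ a → shifted 2 (1 + a)) +
      (sumBelow k (λ a → shifted 1 (2 + a)) + sumBelow k (λ a → shifted 0 (3 + a))))
      ≡⟨ cong₂ (λ u v → sumBelow k (shifted 3) + (u + v)) (sumBelow-rotate (shifted-periodic 2) 1)
           (cong₂ _+_ (sumBelow-rotate (shifted-periodic 1) 2) (sumBelow-rotate (shifted-periodic 0) 3)) ⟩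
    sumBelow k (shifted 3) + (sumBelow k (shifted 2) + (sumBelow k (shifted 1) + sumBelow k (shifted 0)))
      ≡⟨ distrib₄ (shifted 3) (shifted 2) (shifted 1) (shifted 0) ⟨
    sumBelow k (λ a → shifted 3 a + (shifted 2 a + (shifted 1 a + shifted 0 a)))
      ≡⟨ sumBelow-cong k (λ a _ → solve 5 (λ t₀ t₁ t₂ t₃ x → t₃ :* x :+ (t₂ :* x :+ (t₁ :* x :+ t₀ :* x))
                                      := (t₀ :+ (t₁ :+ (t₂ :+ t₃))) :* x) refl
                                    (T a) (T (1 + a)) (T (2 + a)) (T (3 + a)) (X a)) ⟩
    sumBelow k (λ a → ℕΣ.window T a * X a) ∎
    where open ≡-Reasoning

-- Packings, covers and the Mengerian property

sumOver-indicator : ∀ {n} (S : Subset n) (u : Fin n → ℕ) t →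
  ℕΣ.sumOver ⊤ (λ v → u v * (if lookup S v then t else 0)) ≡ t * ℕΣ.sumOver S u
sumOver-indicator []            u t = sym (ℕP.*-zeroʳ t)
sumOver-indicator (inside ∷ S)  u t =
  trans (cong₂ _+_ (ℕP.*-comm (u zero) t) (sumOver-indicator S (u ∘ suc) t)) (sym (ℕP.*-distribˡ-+ t (u zero) _))
sumOver-indicator {suc n} (outside ∷ S) u t =
  trans (cong (_+ ℕΣ.sumOver (⊤ {n}) (λ v → u (suc v) * (if lookup S v then t else 0))) (ℕP.*-zeroʳ (u zero)))
        (sumOver-indicator S (u ∘ suc) t)

sumOver-load : ∀ {n} (L : List (Subset n)) (y : Subset n → ℕ) u →
  ℕΣ.sumOver ⊤ (λ v → u v * sum (map (λ S → if lookup S v then y S else 0) L)) ≡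
  sum (map (λ S → y S * ℕΣ.sumOver S u) L)
sumOver-load {n} []      y u = trans (ℕΣ.sumOver-cong (⊤ {n}) (λ v → ℕP.*-zeroʳ (u v))) (ℕΣ.sumOver-zero (⊤ {n}))
sumOver-load {n} (S ∷ L) y u =
  trans (ℕΣ.sumOver-cong (⊤ {n}) (λ v → ℕP.*-distribˡ-+ (u v) _ _))
    (trans (ℕΣ.sumOver-distrib (⊤ {n}) _ _) (cong₂ _+_ (sumOver-indicator S u (y S)) (sumOver-load L y u)))

sum-weighted-≥ : ∀ {A : Set} d (y w : A → ℕ) (L : List A) → (∀ S → d * y S ≤ y S * w S) →
  d * sum (map y L) ≤ sum (map (λ S → y S * w S) L)
sum-weighted-≥ d y w []      le = ℕP.≤-reflexive (ℕP.*-zeroʳ d)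
sum-weighted-≥ d y w (S ∷ L) le =
  ℕP.≤-trans (ℕP.≤-reflexive (ℕP.*-distribˡ-+ d (y S) _)) (ℕP.+-mono-≤ (le S) (sum-weighted-≥ d y w L le))

module MengerianObstruction (k : ℕ) .{{_ : NonZero k}} (4≤k : 4 ≤ k) where

  open CycleWindows k 4≤k

  cost≡sumBelow : ∀ c x → cost c x ≡ sumBelow k (λ n → c (n mod k) * x (n mod k))
  cost≡sumBelow c x = trans (sumOverℕ≡sumOver (⊤ {k}) (λ i → c i * x i))
    (ℕΣ.sumOver-cong (⊤ {k}) (λ i → cong (λ j → c j * x j) (sym (toℕ-mod-toℕ i))))

  IsCover⇒window≥1 : ∀ {x} → IsCover (H3 (Cycle k)) x → ∀ a → 1 ≤ ℕΣ.window (x ∘ (_mod k)) a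
  IsCover⇒window≥1 {x} covers a = subst (1 ≤_)
    (trans (sumOverℕ≡sumOver (windowSet a) x) (ℕW.sumOver-windowSet a x)) (covers _ (windowSet-hyperedge a))

  packing-bound : ∀ {c u y d} → (∀ a → d ≤ ℕΣ.window (u ∘ (_mod k)) a) →
    IsPacking (H3 (Cycle k)) c y → d * total y ≤ cost u c
  packing-bound {c} {u} {y} {d} u-windows (y-supported , load≤c) = begin
    d * total y
      ≤⟨ sum-weighted-≥ d y (λ S → ℕΣ.sumOver S u) (allSubsets k) per-edge ⟩
    sum (map (λ S → y S * ℕΣ.sumOver S u) (allSubsets k))
      ≡⟨ sumOver-load (allSubsets k) y u ⟨
    ℕΣ.sumOver ⊤ (λ v → u v * _)
      ≤⟨ ℕΣ.sumOver-mono-≼ (⊤ {k}) (λ v → ℕP.*-monoʳ-≤ (u v) (load≤c v)) ⟩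
    ℕΣ.sumOver ⊤ (λ v → u v * c v)
      ≡⟨ sumOverℕ≡sumOver ⊤ (λ v → u v * c v) ⟨
    cost u c ∎
    where
    open ℕP.≤-Reasoning
    per-edge : ∀ S → d * y S ≤ y S * ℕΣ.sumOver S u
    per-edge S with d ≤? ℕΣ.sumOver S u
    ... | yes d≤ΣSu = ℕP.≤-trans (ℕP.≤-reflexive (ℕP.*-comm d (y S))) (ℕP.*-monoʳ-≤ (y S) d≤ΣSu)
    ... | no  d≰ΣSu = subst (λ t → d * t ≤ t * ℕΣ.sumOver S u) (sym (y-supported S not-edge))
                        (ℕP.≤-reflexive (ℕP.*-zeroʳ d))
      where
      not-edge : ¬ H3 (Cycle k) S
      not-edge e = let (a , le) = ℕW.window≼sumOver-hyperedge u (λ _ → z≤n) e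
                   in d≰ΣSu (ℕP.≤-trans (u-windows a) le)

  cover-bound : ∀ {T C : ℕ → ℕ} {d} → Periodic k T → Periodic k C →
    (∀ b → b < k → ℕΣ.window T b ≤ d * C b) →
    ∀ x → (∀ a → 1 ≤ ℕΣ.window (x ∘ (_mod k)) a) → sumBelow k T ≤ d * sumBelow k (λ b → C b * x (b mod k))
  cover-bound {T} {C} {d} T-periodic C-periodic T≤dC x x-windows = begin
    sumBelow k T
      ≡⟨ sumBelow-rotate T-periodic 3 ⟨
    sumBelow k (λ a → T (3 + a))
      ≤⟨ sumBelow-mono-≤ k (λ a _ → ℕP.≤-trans (ℕP.≤-reflexive (sym (ℕP.*-identityʳ (T (3 + a)))))
                                              (ℕP.*-monoʳ-≤ (T (3 + a)) (x-windows a))) ⟩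
    sumBelow k (λ a → T (3 + a) * ℕΣ.window X a)
      ≡⟨ sumBelow-window-adjoint T-periodic X-periodic ⟩
    sumBelow k (λ b → ℕΣ.window T b * X b)
      ≤⟨ sumBelow-mono-≤ k (λ b b<k → ℕP.*-monoˡ-≤ (X b) (T≤dC b b<k)) ⟩
    sumBelow k (λ b → d * C b * X b)
      ≡⟨ sumBelow-cong k (λ b _ → ℕP.*-assoc d (C b) (X b)) ⟩
    sumBelow k (λ b → d * (C b * X b))
      ≡⟨ sumBelow-distribˡ-* k d (λ b → C b * X b) ⟩
    d * sumBelow k (λ b → C b * X b) ∎
    where
    open ℕP.≤-Reasoning
    X = x ∘ (_mod k)
    X-periodic : Periodic k X
    X-periodic n = cong x (mod-periodic n)

  -- u is a fractional packing and T a fractional certificate for covers (the T-load of every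
  -- vertex b is at most d · c b), both of value N / d; an integral min = max would have to be N / d.
  ¬Mengerian-by-window-weights : ∀ (c u : Fin k → ℕ) (T : ℕ → ℕ) d → Periodic k T →
    (∀ b → b < k → ℕΣ.window T b ≤ d * c (b mod k)) →
    (∀ a → d ≤ ℕΣ.window (u ∘ (_mod k)) a) →
    sumBelow k T ≡ cost u c → ¬ d ∣ cost u c → ¬ Mengerian (H3 (Cycle k))
  ¬Mengerian-by-window-weights c u T d T-periodic T≤dc u-windows ΣT≡N d∤N menger
    with menger c
  ... | m , ((x , x-cover , cx≡m) , _) , ((y , y-packing , ty≡m) , _) =
    d∤N (divides m (trans (sym dm≡N) (ℕP.*-comm d m)))
    where
    N≤dm : cost u c ≤ d * m
    N≤dm = begin
      cost u c
        ≡⟨ ΣT≡N ⟨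
      sumBelow k T
        ≤⟨ cover-bound {T} {c ∘ (_mod k)} {d} T-periodic (λ n → cong c (mod-periodic n)) T≤dc x
             (IsCover⇒window≥1 x-cover) ⟩
      d * sumBelow k (λ b → c (b mod k) * x (b mod k))
        ≡⟨ cong (d *_) (trans (sym (cost≡sumBelow c x)) cx≡m) ⟩
      d * m ∎
      where open ℕP.≤-Reasoning
    dm≡N : d * m ≡ cost u c
    dm≡N = ℕP.≤-antisym (subst (λ t → d * t ≤ cost u c) ty≡m (packing-bound {c} {u} {y} {d} u-windows y-packing)) N≤dm

module UnitWeights (k : ℕ) .{{_ : NonZero k}} (4≤k : 4 ≤ k) where

  open MengerianObstruction k 4≤k

  ¬Mengerian-unit : ¬ 4 ∣ k → ¬ Mengerian (H3 (Cycle k))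
  ¬Mengerian-unit 4∤k = ¬Mengerian-by-window-weights one one (const 1) 4 (λ _ → refl)
    (λ _ _ → ℕP.≤-refl) (λ _ → ℕP.≤-refl) (sym (cost≡sumBelow one one)) (4∤k ∘ subst (4 ∣_) cost≡k)
    where
    one : Fin k → ℕ
    one _ = 1
    cost≡k : cost one one ≡ k
    cost≡k = trans (cost≡sumBelow one one) (sumBelow-1 k)

¬∣-offset : ∀ {d} r N → d ∣ N → ¬ d ∣ r → ¬ d ∣ r + N
¬∣-offset {d} r N d∣N d∤r d∣r+N = d∤r (∣m+n∣m⇒∣n (subst (d ∣_) (ℕP.+-comm r N) d∣r+N) d∣N)

-- Odd cycles

¼ : ℚ
¼ = ℤ.+ 1 ℚ./ 4

module _ where
  open ℚSolver.+-*-Solver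

  window-shift-cancel : ∀ (Y : ℕ → ℚ) a → ℚΣ.window Y a ≡ ℚΣ.window Y (suc a) → Y (4 + a) ≡ Y a
  window-shift-cancel Y a eq = begin
    Y (4 + a)
      ≡⟨ solve 4 (λ y₁ y₂ y₃ y₄ → y₄ := (y₁ :+ (y₂ :+ (y₃ :+ y₄))) :- (y₁ :+ (y₂ :+ y₃))) refl
           (Y (1 + a)) (Y (2 + a)) (Y (3 + a)) (Y (4 + a)) ⟩
    ℚΣ.window Y (suc a) ℚ.- middle
      ≡⟨ cong (ℚ._- middle) eq ⟨
    ℚΣ.window Y a ℚ.- middle
      ≡⟨ solve 4 (λ y₀ y₁ y₂ y₃ → (y₀ :+ (y₁ :+ (y₂ :+ y₃))) :- (y₁ :+ (y₂ :+ y₃)) := y₀) refl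
           (Y a) (Y (1 + a)) (Y (2 + a)) (Y (3 + a)) ⟩
    Y a ∎
    where
    open ≡-Reasoning
    middle = Y (1 + a) ℚ.+ (Y (2 + a) ℚ.+ Y (3 + a))

  four-quarters : ∀ {a} → a ℚ.+ (a ℚ.+ (a ℚ.+ a)) ≡ 1ℚ → a ≡ ¼
  four-quarters {a} 4a≡1 = trans (solve 1 (λ a → a := con ¼ :* (a :+ (a :+ (a :+ a)))) refl a) (cong (¼ ℚ.*_) 4a≡1)

module OddCycle (k : ℕ) .{{_ : NonZero k}} (4≤k : 4 ≤ k)
  (periods-coprime : ∀ {Y : ℕ → ℚ} → Periodic 4 Y → Periodic k Y → Periodic 1 Y) (4∤k : ¬ 4 ∣ k) where

  open CycleVertices k 4≤k
  open CycleArithmetic k using (toℕ-mod-toℕ; mod-periodic)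

  quarter : Fin k → ℚ
  quarter _ = ¼

  quarter-feasible : WindowFeasible quarter
  quarter-feasible = (λ _ → from-yes (0ℚ ℚ.≤? ¼)) , (λ _ → ℚP.≤-refl)

  quarter-determined : TightnessDetermines quarter
  quarter-determined y _ _ tight i = begin
    y i         ≡⟨ cong y (toℕ-mod-toℕ i) ⟨
    Y (toℕ i)   ≡⟨ Periodic1⇒constant period1 (toℕ i) ⟩
    Y 0         ≡⟨ four-quarters (trans (cong₂ (λ u v → Y 0 ℚ.+ (u ℚ.+ v)) (constant 1)
                     (cong₂ ℚ._+_ (constant 2) (constant 3))) (tight 0 refl)) ⟩
    ¼           ∎
    where
    open ≡-Reasoning
    Y = y ∘ (_mod k)
    period4 : Periodic 4 Y
    period4 n = trans (cong Y (ℕP.+-comm n 4))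
                  (window-shift-cancel Y n (trans (tight n refl) (sym (tight (suc n) refl))))
    period1 : Periodic 1 Y
    period1 = periods-coprime period4 (λ n → cong y (mod-periodic n))
    constant : ∀ n → Y 0 ≡ Y n
    constant n = sym (Periodic1⇒constant period1 n)

  not-ideal-nor-Mengerian : ¬ Ideal (H3 (Cycle k)) × ¬ Mengerian (H3 (Cycle k))
  not-ideal-nor-Mengerian =
    ¬Ideal quarter-feasible quarter-determined (0 mod k) (nonIntegral λ ()) ,
    UnitWeights.¬Mengerian-unit k 4≤k 4∤k

-- Half-integral points

isEven : ℕ → Bool
isEven zero          = true
isEven (suc zero)    = false
isEven (suc (suc n)) = isEven n

isEven-suc : ∀ n → isEven (suc n) ≡ not (isEven n)
isEven-suc zero          = refl
isEven-suc (suc zero)    = refl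
isEven-suc (suc (suc n)) = isEven-suc n

isEven-*2 : ∀ j → isEven (j * 2) ≡ true
isEven-*2 zero    = refl
isEven-*2 (suc j) = isEven-*2 j

isEven-1+*2 : ∀ j → isEven (suc (j * 2)) ≡ false
isEven-1+*2 zero    = refl
isEven-1+*2 (suc j) = isEven-1+*2 j

isEven-*4 : ∀ q → isEven (q * 4) ≡ true
isEven-*4 zero    = refl
isEven-*4 (suc q) = isEven-*4 q

isEven-1+*4 : ∀ q → isEven (suc (q * 4)) ≡ false
isEven-1+*4 q = trans (isEven-suc (q * 4)) (cong not (isEven-*4 q))

isEven⇒*2 : ∀ n → isEven n ≡ true → ∃[ j ] n ≡ j * 2
isEven⇒*2 zero          _    = 0 , refl
isEven⇒*2 (suc (suc n)) even = let (j , n≡2j) = isEven⇒*2 n even in suc j , cong (λ t → suc (suc t)) n≡2j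

isEven-periodic : Periodic 2 isEven
isEven-periodic zero          = refl
isEven-periodic (suc zero)    = refl
isEven-periodic (suc (suc n)) = isEven-periodic n

halfOf : Bool → ℚ
halfOf b = if b then ½ else 0ℚ

indicator : Bool → ℕ
indicator b = if b then 1 else 0

indicator≤1 : ∀ b → indicator b ≤ 1
indicator≤1 true  = ℕP.≤-refl
indicator≤1 false = z≤n

isEven-window : ∀ m → ℕΣ.window (indicator ∘ isEven) m ≡ 2
isEven-window m rewrite isEven-suc m with isEven m
... | true  = refl
... | false = refl

halfOf-nonneg : ∀ b → 0ℚ ℚ.≤ halfOf b
halfOf-nonneg true  = from-yes (0ℚ ℚ.≤? ½)
halfOf-nonneg false = ℚP.≤-refl

halves-≥1 : ∀ b₀ b₁ b₂ b₃ → 2 ≤ indicator b₀ + (indicator b₁ + (indicator b₂ + indicator b₃)) →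
  1ℚ ℚ.≤ halfOf b₀ ℚ.+ (halfOf b₁ ℚ.+ (halfOf b₂ ℚ.+ halfOf b₃))
halves-≥1 true  true  true  true  _ = toWitness {a? = 1ℚ ℚ.≤? _} _
halves-≥1 true  true  true  false _ = toWitness {a? = 1ℚ ℚ.≤? _} _
halves-≥1 true  true  false true  _ = toWitness {a? = 1ℚ ℚ.≤? _} _
halves-≥1 true  true  false false _ = toWitness {a? = 1ℚ ℚ.≤? _} _
halves-≥1 true  false true  true  _ = toWitness {a? = 1ℚ ℚ.≤? _} _
halves-≥1 true  false true  false _ = toWitness {a? = 1ℚ ℚ.≤? _} _
halves-≥1 true  false false true  _ = toWitness {a? = 1ℚ ℚ.≤? _} _
halves-≥1 false true  true  true  _ = toWitness {a? = 1ℚ ℚ.≤? _} _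
halves-≥1 false true  true  false _ = toWitness {a? = 1ℚ ℚ.≤? _} _
halves-≥1 false true  false true  _ = toWitness {a? = 1ℚ ℚ.≤? _} _
halves-≥1 false false true  true  _ = toWitness {a? = 1ℚ ℚ.≤? _} _
halves-≥1 true  false false false (s≤s ())
halves-≥1 false true  false false (s≤s ())
halves-≥1 false false true  false (s≤s ())
halves-≥1 false false false true  (s≤s ())
halves-≥1 false false false false ()

module _ where
  open ℚSolver.+-*-Solver

  complement : ∀ a {b} → a ℚ.+ b ≡ 1ℚ → b ≡ 1ℚ ℚ.- a
  complement a {b} a+b≡1 = trans (solve 2 (λ a b → b := (a :+ b) :- a) refl a b) (cong (ℚ._- a) a+b≡1)

  complement-involutive : ∀ a → 1ℚ ℚ.- (1ℚ ℚ.- a) ≡ a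
  complement-involutive = solve 1 (λ a → con 1ℚ :- (con 1ℚ :- a) := a) refl

  self-complement : ∀ {a} → a ≡ 1ℚ ℚ.- a → a ≡ ½
  self-complement {a} a≡1-a = begin
    a                           ≡⟨ solve 1 (λ a → a := con ½ :* (a :+ a)) refl a ⟩
    ½ ℚ.* (a ℚ.+ a)             ≡⟨ cong (λ t → ½ ℚ.* (a ℚ.+ t)) a≡1-a ⟩
    ½ ℚ.* (a ℚ.+ (1ℚ ℚ.- a))    ≡⟨ solve 1 (λ a → con ½ :* (a :+ (con 1ℚ :- a)) := con ½) refl a ⟩
    ½                           ∎
    where open ≡-Reasoning

-- Consecutive values summing to 1 alternate between g 0 and 1 - g 0; closing up after an odd
-- number of steps forces g 0 = 1 - g 0.
alternating-halves : ∀ (g : ℕ → ℚ) m → (∀ i → i ≤ m * 2 → g i ℚ.+ g (suc i) ≡ 1ℚ) →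
  g (suc (m * 2)) ≡ g 0 → ∀ i → i ≤ suc (m * 2) → g i ≡ ½
alternating-halves g m pairs closed = all-½
  where
  alternation : ∀ j → j ≤ m → g (j * 2) ≡ g 0 × g (suc (j * 2)) ≡ 1ℚ ℚ.- g 0
  alternation zero    _     = refl , complement (g 0) (pairs 0 z≤n)
  alternation (suc j) 1+j≤m =
    even , trans (complement (g (suc j * 2)) (pairs (suc j * 2) 2+2j≤2m)) (cong (λ t → 1ℚ ℚ.- t) even)
    where
    2+2j≤2m : suc j * 2 ≤ m * 2
    2+2j≤2m = ℕP.*-monoˡ-≤ 2 1+j≤m
    even : g (suc j * 2) ≡ g 0
    even = trans (complement (g (suc (j * 2))) (pairs (suc (j * 2)) (ℕP.≤-trans (ℕP.n≤1+n _) 2+2j≤2m)))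
             (trans (cong (λ t → 1ℚ ℚ.- t) (proj₂ (alternation j (ℕP.<⇒≤ 1+j≤m)))) (complement-involutive (g 0)))
  g₀≡½ : g 0 ≡ ½
  g₀≡½ = self-complement (trans (sym closed) (proj₂ (alternation m ℕP.≤-refl)))
  all-½ : ∀ i → i ≤ suc (m * 2) → g i ≡ ½
  all-½ zero    _          = g₀≡½
  all-½ (suc i) (s≤s i≤2m) =
    trans (complement (g i) (pairs i i≤2m)) (cong (λ t → 1ℚ ℚ.- t) (all-½ i (ℕP.m≤n⇒m≤1+n i≤2m)))

-- P is a pattern on ℕ; the point is ½ on the support of P restricted to 0, …, k - 1,
-- and Pc is the k-periodic pattern it reads off through n mod k.
module HalfIntegral (k : ℕ) .{{_ : NonZero k}} (4≤k : 4 ≤ k) (P : ℕ → Bool) where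

  open CycleVertices k 4≤k public
  open CycleArithmetic k using (toℕ-mod; toℕ-mod-toℕ)

  x : Fin k → ℚ
  x i = halfOf (P (toℕ i))

  Pc : ℕ → Bool
  Pc n = P (n % k)

  x-mod : ∀ n → x (n mod k) ≡ halfOf (Pc n)
  x-mod n = cong (halfOf ∘ P) (toℕ-mod n)

  count : ℕ → ℕ
  count = ℕΣ.window (indicator ∘ Pc)

  x-feasible : (∀ a → 2 ≤ count a) → WindowFeasible x
  x-feasible count≥2 = (λ i → halfOf-nonneg (P (toℕ i))) , λ a →
    subst (1ℚ ℚ.≤_) (sym (ℚΣ.window-cong x-mod a))
      (halves-≥1 (Pc a) (Pc (1 + a)) (Pc (2 + a)) (Pc (3 + a)) (count≥2 a))

  SupportHalves : Set
  SupportHalves = ∀ y → (∀ i → x i ≡ 0ℚ → y i ≡ 0ℚ) → (∀ a → W x a ≡ 1ℚ → W y a ≡ 1ℚ) →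
    ∀ n → n < k → P n ≡ true → y (n mod k) ≡ ½

  determined : SupportHalves → TightnessDetermines x
  determined support-halves y _ y-zero y-tight i with P (toℕ i) in Pᵢ
  ... | true  = trans (cong y (sym (toℕ-mod-toℕ i))) (support-halves y y-zero y-tight (toℕ i) (toℕ<n i) Pᵢ)
  ... | false = y-zero i (cong halfOf Pᵢ)

  module Tight (y : Fin k → ℚ) (y-zero : ∀ i → x i ≡ 0ℚ → y i ≡ 0ℚ)
               (y-tight : ∀ a → W x a ≡ 1ℚ → W y a ≡ 1ℚ) where

    Y : ℕ → ℚ
    Y = y ∘ (_mod k)

    Y-off-support : ∀ n → Pc n ≡ false → Y n ≡ 0ℚ
    Y-off-support n Pcₙ≡false = y-zero (n mod k) (trans (x-mod n) (cong halfOf Pcₙ≡false))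

    masked : ∀ n → Y n ≡ (if Pc n then Y n else 0ℚ)
    masked n with Pc n in Pcₙ
    ... | true  = refl
    ... | false = Y-off-support n Pcₙ

    tight-pattern : ∀ a {b₀ b₁ b₂ b₃} → Pc a ≡ b₀ → Pc (1 + a) ≡ b₁ → Pc (2 + a) ≡ b₂ → Pc (3 + a) ≡ b₃ →
      halfOf b₀ ℚ.+ (halfOf b₁ ℚ.+ (halfOf b₂ ℚ.+ halfOf b₃)) ≡ 1ℚ →
      (if b₀ then Y a else 0ℚ) ℚ.+ ((if b₁ then Y (1 + a) else 0ℚ) ℚ.+
        ((if b₂ then Y (2 + a) else 0ℚ) ℚ.+ (if b₃ then Y (3 + a) else 0ℚ))) ≡ 1ℚ
    tight-pattern a refl refl refl refl halves≡1 =
      trans (sym (ℚΣ.window-cong masked a)) (y-tight a (trans (ℚΣ.window-cong x-mod a) halves≡1))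

    open ℚSolver.+-*-Solver

    pair-1010 : ∀ a → Pc a ≡ true → Pc (1 + a) ≡ false → Pc (2 + a) ≡ true → Pc (3 + a) ≡ false →
      Y a ℚ.+ Y (2 + a) ≡ 1ℚ
    pair-1010 a e₀ e₁ e₂ e₃ =
      trans (solve 2 (λ p q → p :+ q := p :+ (con 0ℚ :+ (q :+ con 0ℚ))) refl (Y a) (Y (2 + a)))
            (tight-pattern a e₀ e₁ e₂ e₃ refl)

    pair-0101 : ∀ a → Pc a ≡ false → Pc (1 + a) ≡ true → Pc (2 + a) ≡ false → Pc (3 + a) ≡ true →
      Y (1 + a) ℚ.+ Y (3 + a) ≡ 1ℚ
    pair-0101 a e₀ e₁ e₂ e₃ =
      trans (solve 2 (λ p q → p :+ q := con 0ℚ :+ (p :+ (con 0ℚ :+ q))) refl (Y (1 + a)) (Y (3 + a)))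
            (tight-pattern a e₀ e₁ e₂ e₃ refl)

    pair-0110 : ∀ a → Pc a ≡ false → Pc (1 + a) ≡ true → Pc (2 + a) ≡ true → Pc (3 + a) ≡ false →
      Y (1 + a) ℚ.+ Y (2 + a) ≡ 1ℚ
    pair-0110 a e₀ e₁ e₂ e₃ =
      trans (solve 2 (λ p q → p :+ q := con 0ℚ :+ (p :+ (q :+ con 0ℚ))) refl (Y (1 + a)) (Y (2 + a)))
            (tight-pattern a e₀ e₁ e₂ e₃ refl)

module TwiceOddCycle (m : ℕ) where

  k : ℕ
  k = suc (suc m * 2) * 2

  4≤k : 4 ≤ k
  4≤k = ℕP.m≤m+n 4 _

  open HalfIntegral k 4≤k isEven
  open CycleArithmetic k using (mod-periodic)

  Pc≡isEven : ∀ n → Pc n ≡ isEven n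
  Pc≡isEven = Periodic⇒%-invariant (Periodic-* isEven-periodic (suc (suc m * 2)))

  count≥2 : ∀ a → 2 ≤ count a
  count≥2 a = ℕP.≤-reflexive (sym (trans (ℕΣ.window-cong (cong indicator ∘ Pc≡isEven) a) (isEven-window a)))

  support-halves : SupportHalves
  support-halves y y-zero y-tight n n<k isEven-n with isEven⇒*2 n isEven-n
  ... | j , refl = alternating-halves g (suc m) pairs closed j (ℕP.<⇒≤ (ℕP.*-cancelʳ-< 2 j (suc (suc m * 2)) n<k))
    where
    open Tight y y-zero y-tight
    g : ℕ → ℚ
    g i = Y (i * 2)
    pairs : ∀ i → i ≤ suc m * 2 → g i ℚ.+ g (suc i) ≡ 1ℚ
    pairs i _ = pair-1010 (i * 2) (trans (Pc≡isEven (i * 2)) (isEven-*2 i))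
                  (trans (Pc≡isEven (1 + i * 2)) (isEven-1+*2 i)) (trans (Pc≡isEven (2 + i * 2)) (isEven-*2 (suc i)))
                  (trans (Pc≡isEven (3 + i * 2)) (isEven-1+*2 (suc i)))
    closed : g (suc (suc m * 2)) ≡ g 0
    closed = cong y (mod-periodic 0)

  4∤k : ¬ 4 ∣ k
  4∤k = ¬∣-offset 2 (suc m * 2 * 2) (divides (suc m) (ℕP.*-assoc (suc m) 2 2)) (from-no (4 ∣? 2))

  not-ideal-nor-Mengerian : ¬ Ideal (H3 (Cycle k)) × ¬ Mengerian (H3 (Cycle k))
  not-ideal-nor-Mengerian =
    ¬Ideal (x-feasible count≥2) (determined support-halves) (0 mod k)
      (λ q x₀≡q → nonIntegral (λ ()) q (trans (sym (trans (x-mod 0) (cong halfOf (Pc≡isEven 0)))) x₀≡q)) ,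
    UnitWeights.¬Mengerian-unit k 4≤k 4∤k

-- Cycles of length divisible by 4

-- The alternation 1010… with two defects 11, at 6–7 and at 11–12: every window still holds two or
-- three 1s, and the support vertices 0, 2, 4, 6, 7, 9, 11, 12, 14, … (consecutive ones lying in a
-- common tight window) close up around a cycle of length 12 + 4q after 7 + 2q steps, an odd number.
defectPattern : ℕ → Bool
defectPattern 0  = true
defectPattern 1  = false
defectPattern 2  = true
defectPattern 3  = false
defectPattern 4  = true
defectPattern 5  = false
defectPattern 6  = true
defectPattern 7  = true
defectPattern 8  = false
defectPattern 9  = true
defectPattern 10 = false
defectPattern 11 = true
defectPattern (suc (suc (suc (suc (suc (suc (suc (suc (suc (suc (suc (suc m)))))))))))) = isEven m

defectPattern-count≥2 : ∀ a → 2 ≤ ℕΣ.window (indicator ∘ defectPattern) a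
defectPattern-count≥2 0  = s≤s (s≤s z≤n)
defectPattern-count≥2 1  = s≤s (s≤s z≤n)
defectPattern-count≥2 2  = s≤s (s≤s z≤n)
defectPattern-count≥2 3  = s≤s (s≤s z≤n)
defectPattern-count≥2 4  = s≤s (s≤s z≤n)
defectPattern-count≥2 5  = s≤s (s≤s z≤n)
defectPattern-count≥2 6  = s≤s (s≤s z≤n)
defectPattern-count≥2 7  = s≤s (s≤s z≤n)
defectPattern-count≥2 8  = s≤s (s≤s z≤n)
defectPattern-count≥2 9  = s≤s (s≤s z≤n)
defectPattern-count≥2 10 = s≤s (s≤s z≤n)
defectPattern-count≥2 11 = s≤s (s≤s z≤n)
defectPattern-count≥2 (suc (suc (suc (suc (suc (suc (suc (suc (suc (suc (suc (suc m)))))))))))) =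
  ℕP.≤-reflexive (sym (isEven-window m))

defectPattern-sparse : ∀ b → defectPattern b ≡ true → ℕΣ.window (indicator ∘ defectPattern) (suc b) ≤ 2
defectPattern-sparse 0  _ = ℕP.≤-refl
defectPattern-sparse 2  _ = ℕP.≤-refl
defectPattern-sparse 4  _ = ℕP.≤-refl
defectPattern-sparse 6  _ = ℕP.≤-refl
defectPattern-sparse 7  _ = ℕP.≤-refl
defectPattern-sparse 9  _ = ℕP.≤-refl
defectPattern-sparse 11 _ = ℕP.≤-refl
defectPattern-sparse (suc (suc (suc (suc (suc (suc (suc (suc (suc (suc (suc (suc m)))))))))))) _ =
  ℕP.≤-reflexive (isEven-window (suc m))

defectChain : ℕ → ℕ
defectChain 0 = 0
defectChain 1 = 2
defectChain 2 = 4
defectChain 3 = 6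
defectChain 4 = 7
defectChain 5 = 9
defectChain 6 = 11
defectChain (suc (suc (suc (suc (suc (suc (suc j))))))) = 12 + j * 2

sumBelow-isEven : ∀ q → sumBelow (q * 4) (indicator ∘ isEven) ≡ q * 2
sumBelow-isEven zero    = refl
sumBelow-isEven (suc q) = cong (2 +_) (sumBelow-isEven q)

module DefectCycle (q : ℕ) where

  k : ℕ
  k = 12 + q * 4

  4≤k : 4 ≤ k
  4≤k = ℕP.m≤m+n 4 (8 + q * 4)

  open HalfIntegral k 4≤k defectPattern
  open CycleArithmetic k using (mod-periodic; toℕ-mod)

  defectPattern-wraps : ∀ r → r < 7 → defectPattern (r + k) ≡ defectPattern r
  defectPattern-wraps 0 _ = isEven-*4 q
  defectPattern-wraps 1 _ = isEven-1+*4 q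
  defectPattern-wraps 2 _ = isEven-*4 q
  defectPattern-wraps 3 _ = isEven-1+*4 q
  defectPattern-wraps 4 _ = isEven-*4 q
  defectPattern-wraps 5 _ = isEven-1+*4 q
  defectPattern-wraps 6 _ = isEven-*4 q
  defectPattern-wraps (suc (suc (suc (suc (suc (suc (suc _))))))) (s≤s (s≤s (s≤s (s≤s (s≤s (s≤s (s≤s ())))))))

  Pc≡defectPattern : ∀ n → n < 7 + k → Pc n ≡ defectPattern n
  Pc≡defectPattern = %-wrap defectPattern 7 (ℕP.m≤m+n 7 (5 + q * 4)) defectPattern-wraps

  <k⇒<7+k : ∀ {n} → n < k → n < 7 + k
  <k⇒<7+k n<k = ℕP.≤-trans n<k (ℕP.m≤n+m k 7)

  Pc-small : ∀ n {n<19 : True (n <? 19)} → Pc n ≡ defectPattern n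
  Pc-small n {n<19} = Pc≡defectPattern n (ℕP.≤-trans (toWitness n<19) (ℕP.m≤m+n 19 (q * 4)))

  Pc-periodic : Periodic k Pc
  Pc-periodic n = cong defectPattern ([m+n]%n≡m%n n k)

  count-wraps : ∀ a → a < 4 + k → count a ≡ ℕΣ.window (indicator ∘ defectPattern) a
  count-wraps a a<4+k = cong₂ _+_ (agree 0 z≤n) (cong₂ _+_ (agree 1 (s≤s z≤n))
                          (cong₂ _+_ (agree 2 (s≤s (s≤s z≤n))) (agree 3 (s≤s (s≤s (s≤s z≤n))))))
    where
    agree : ∀ t → t ≤ 3 → indicator (Pc (t + a)) ≡ indicator (defectPattern (t + a))
    agree t t≤3 = cong indicator (Pc≡defectPattern (t + a) (ℕP.+-mono-≤-< t≤3 a<4+k))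

  count≥2 : ∀ a → 2 ≤ count a
  count≥2 a = subst (2 ≤_) (trans (sym (count-wraps (a % k) (ℕP.<-≤-trans (m%n<n a k) (ℕP.m≤n+m k 4))))
                                  (Periodic⇒%-invariant (window-periodic Pc-indicator-periodic) a))
                (defectPattern-count≥2 (a % k))
    where
    Pc-indicator-periodic : Periodic k (indicator ∘ Pc)
    Pc-indicator-periodic n = cong indicator (Pc-periodic n)

  on-chain : ∀ n → n < k → defectPattern n ≡ true → ∃[ i ] i ≤ 7 + q * 2 × defectChain i ≡ n
  on-chain 0  _ _ = 0 , z≤n , refl
  on-chain 2  _ _ = 1 , s≤s z≤n , refl
  on-chain 4  _ _ = 2 , s≤s (s≤s z≤n) , refl
  on-chain 6  _ _ = 3 , s≤s (s≤s (s≤s z≤n)) , refl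
  on-chain 7  _ _ = 4 , s≤s (s≤s (s≤s (s≤s z≤n))) , refl
  on-chain 9  _ _ = 5 , s≤s (s≤s (s≤s (s≤s (s≤s z≤n)))) , refl
  on-chain 11 _ _ = 6 , s≤s (s≤s (s≤s (s≤s (s≤s (s≤s z≤n))))) , refl
  on-chain (suc (suc (suc (suc (suc (suc (suc (suc (suc (suc (suc (suc m)))))))))))) n<k even
    with isEven⇒*2 m even
  ... | j , refl = 7 + j , ℕP.+-monoʳ-≤ 7 (ℕP.<⇒≤ j<2q) , refl
    where
    j<2q : j < q * 2
    j<2q = ℕP.*-cancelʳ-< 2 j (q * 2)
             (subst (j * 2 <_) (sym (ℕP.*-assoc q 2 2)) (ℕP.+-cancelˡ-< 12 (j * 2) (q * 4) n<k))

  support-halves : SupportHalves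
  support-halves y y-zero y-tight n n<k on-support with on-chain n n<k on-support
  ... | i , i≤L , refl = alternating-halves g (3 + q) pairs closed i i≤L
    where
    open Tight y y-zero y-tight
    g : ℕ → ℚ
    g = Y ∘ defectChain
    closed : g (7 + q * 2) ≡ g 0
    closed = trans (cong (λ t → Y (12 + t)) (ℕP.*-assoc q 2 2)) (cong y (mod-periodic 0))
    pairs : ∀ i → i ≤ 6 + q * 2 → g i ℚ.+ g (suc i) ≡ 1ℚ
    pairs 0 _ = pair-1010 0  (Pc-small 0)  (Pc-small 1)  (Pc-small 2)  (Pc-small 3)
    pairs 1 _ = pair-1010 2  (Pc-small 2)  (Pc-small 3)  (Pc-small 4)  (Pc-small 5)
    pairs 2 _ = pair-0101 3  (Pc-small 3)  (Pc-small 4)  (Pc-small 5)  (Pc-small 6)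
    pairs 3 _ = pair-0110 5  (Pc-small 5)  (Pc-small 6)  (Pc-small 7)  (Pc-small 8)
    pairs 4 _ = pair-1010 7  (Pc-small 7)  (Pc-small 8)  (Pc-small 9)  (Pc-small 10)
    pairs 5 _ = pair-0101 8  (Pc-small 8)  (Pc-small 9)  (Pc-small 10) (Pc-small 11)
    pairs 6 _ = pair-0110 10 (Pc-small 10) (Pc-small 11) (Pc-small 12) (Pc-small 13)
    pairs (suc (suc (suc (suc (suc (suc (suc j))))))) 7+j≤6+2q =
      pair-1010 (12 + j * 2) (agree 0 z≤n (isEven-*2 j)) (agree 1 (s≤s z≤n) (isEven-1+*2 j))
        (agree 2 (s≤s (s≤s z≤n)) (isEven-*2 j)) (agree 3 (s≤s (s≤s (s≤s z≤n))) (isEven-1+*2 j))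
      where
      2j≤4q : j * 2 ≤ q * 4
      2j≤4q = subst (j * 2 ≤_) (ℕP.*-assoc q 2 2) (ℕP.*-monoˡ-≤ 2 (ℕP.<⇒≤ (ℕP.+-cancelˡ-≤ 6 (suc j) (q * 2) 7+j≤6+2q)))
      agree : ∀ t {b} → t ≤ 3 → defectPattern (t + (12 + j * 2)) ≡ b → Pc (t + (12 + j * 2)) ≡ b
      agree t t≤3 = trans (Pc≡defectPattern _
        (s≤s (ℕP.+-mono-≤ t≤3 (ℕP.+-monoʳ-≤ 12 (ℕP.≤-trans 2j≤4q (ℕP.m≤n+m (q * 4) 3))))))

  not-ideal : ¬ Ideal (H3 (Cycle k))
  not-ideal = ¬Ideal (x-feasible count≥2) (determined support-halves) (0 mod k)
    (λ m x₀≡m → nonIntegral (λ ()) m (trans (sym (trans (x-mod 0) (cong halfOf (Pc-small 0)))) x₀≡m))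

  open MengerianObstruction k 4≤k using (¬Mengerian-by-window-weights; cost≡sumBelow)

  weight : Bool → ℕ
  weight b = if b then 1 else 2

  c u : Fin k → ℕ
  c i = weight (defectPattern (toℕ i))
  u i = indicator (defectPattern (toℕ i))

  T : ℕ → ℕ
  T n = indicator (Pc (suc n))

  T-periodic : Periodic k T
  T-periodic n = cong indicator (Pc-periodic (suc n))

  T-window≤2c : ∀ b → b < k → ℕΣ.window T b ≤ 2 * c (b mod k)
  T-window≤2c b b<k = subst (λ w → ℕΣ.window T b ≤ 2 * w) (sym (cong (weight ∘ defectPattern) (toℕ-mod b)))
                        (bound (Pc b) refl)
    where
    bound : ∀ β → Pc b ≡ β → ℕΣ.window T b ≤ 2 * weight β
    bound true  Pc-b = ℕP.≤-trans (ℕP.≤-reflexive (count-wraps (suc b) (s≤s (ℕP.≤-trans b<k (ℕP.m≤n+m k 3)))))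
                         (defectPattern-sparse b (trans (sym (Pc≡defectPattern b (<k⇒<7+k b<k))) Pc-b))
    bound false _    = ℕP.+-mono-≤ (indicator≤1 (Pc (1 + b))) (ℕP.+-mono-≤ (indicator≤1 (Pc (2 + b)))
                         (ℕP.+-mono-≤ (indicator≤1 (Pc (3 + b))) (indicator≤1 (Pc (4 + b)))))

  u-windows : ∀ a → 2 ≤ ℕΣ.window (u ∘ (_mod k)) a
  u-windows a = subst (2 ≤_) (ℕΣ.window-cong (λ n → cong (indicator ∘ defectPattern) (sym (toℕ-mod n))) a) (count≥2 a)

  cost-u-c≡support : cost u c ≡ sumBelow k (indicator ∘ Pc)
  cost-u-c≡support = trans (cost≡sumBelow u c) (sumBelow-cong k (λ n _ →
    trans (cong (λ b → indicator b * weight b) (cong defectPattern (toℕ-mod n))) (indicator*weight (Pc n))))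
    where
    indicator*weight : ∀ b → indicator b * weight b ≡ indicator b
    indicator*weight true  = refl
    indicator*weight false = refl

  support-size : sumBelow k (indicator ∘ Pc) ≡ 7 + q * 2
  support-size = trans (sumBelow-cong k (λ n n<k → cong indicator (Pc≡defectPattern n (<k⇒<7+k n<k))))
                       (cong (7 +_) (sumBelow-isEven q))

  not-Mengerian : ¬ Mengerian (H3 (Cycle k))
  not-Mengerian = ¬Mengerian-by-window-weights c u T 2 T-periodic T-window≤2c u-windows
    (trans (sumBelow-rotate₁ (λ n → cong indicator (Pc-periodic n))) (sym cost-u-c≡support))
    (subst (¬_ ∘ (2 ∣_)) (sym (trans cost-u-c≡support support-size))
      (¬∣-offset 7 (q * 2) (divides q refl) (from-no (2 ∣? 7))))

  not-ideal-nor-Mengerian : ¬ Ideal (H3 (Cycle k)) × ¬ Mengerian (H3 (Cycle k))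
  not-ideal-nor-Mengerian = not-ideal , not-Mengerian

data CycleLength : ℕ → Set where
  1+4m   : ∀ m → CycleLength (1 + suc m * 4)
  3+4m   : ∀ m → CycleLength (3 + suc m * 4)
  2+4m   : ∀ m → CycleLength (suc (suc m * 2) * 2)
  12+4q  : ∀ q → CycleLength (12 + q * 4)

CycleLength-+4 : ∀ {k} → CycleLength k → CycleLength (4 + k)
CycleLength-+4 (1+4m m)  = 1+4m (suc m)
CycleLength-+4 (3+4m m)  = 3+4m (suc m)
CycleLength-+4 (2+4m m)  = 2+4m (suc m)
CycleLength-+4 (12+4q q) = 12+4q (suc q)

cycleLength : ∀ k → 5 ≤ k → k ≢ 8 → CycleLength k
cycleLength 0 () _
cycleLength 1 (s≤s ()) _
cycleLength 2 (s≤s (s≤s ())) _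
cycleLength 3 (s≤s (s≤s (s≤s ()))) _
cycleLength 4 (s≤s (s≤s (s≤s (s≤s ())))) _
cycleLength 5  _ _ = 1+4m 0
cycleLength 6  _ _ = 2+4m 0
cycleLength 7  _ _ = 3+4m 0
cycleLength 8  _ k≢8 = contradiction refl k≢8
cycleLength 9  _ _ = 1+4m 1
cycleLength 10 _ _ = 2+4m 1
cycleLength 11 _ _ = 3+4m 1
cycleLength 12 _ _ = 12+4q 0
cycleLength (suc (suc (suc (suc (suc (suc (suc (suc (suc (suc (suc (suc (suc r))))))))))))) _ _ =
  CycleLength-+4 (cycleLength (suc (suc (suc (suc (suc (suc (suc (suc (suc r)))))))))
                                (s≤s (s≤s (s≤s (s≤s (s≤s z≤n))))) λ ())

lemma3p11 : (k : ℕ) → .{{_ : NonZero k}} → 5 ≤ k → k ≢ 8 →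
    ¬ Ideal (H3 (Cycle k)) × ¬ Mengerian (H3 (Cycle k))
lemma3p11 k 5≤k k≢8 with cycleLength k 5≤k k≢8
... | 1+4m m  = OddCycle.not-ideal-nor-Mengerian k (ℕP.m≤m+n 4 _)
                  (λ per₄ perₖ → Periodic-reduce per₄ 1 (suc m) perₖ)
                  (¬∣-offset 1 (suc m * 4) (divides (suc m) refl) (from-no (4 ∣? 1)))
... | 3+4m m  = OddCycle.not-ideal-nor-Mengerian k (ℕP.m≤m+n 4 _)
                  (λ per₄ perₖ → Periodic-reduce (Periodic-reduce per₄ 3 (suc m) perₖ) 1 1 per₄)
                  (¬∣-offset 3 (suc m * 4) (divides (suc m) refl) (from-no (4 ∣? 3)))
... | 2+4m m  = TwiceOddCycle.not-ideal-nor-Mengerian m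
... | 12+4q q = DefectCycle.not-ideal-nor-Mengerian q
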